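{- Let $\mathbb{C}$ be a nonempty simplicial complex of dimension $n\ge 1$. For every $i\in\mathbb{N}$, the operators $\gamma^{\uparrow\downarrow}_i=(\delta^{\uparrow\downarrow})^i(\varepsilon^{\uparrow\downarrow})^i$ and $\phi^{\uparrow\downarrow}_i=(\varepsilon^{\uparrow\downarrow})^i(\delta^{\uparrow\downarrow})^i$ map subcomplexes of $\mathbb{C}$ to subcomplexes of $\mathbb{C}$; $\gamma^{\uparrow\downarrow}_i$ is an opening and $\phi^{\uparrow\downarrow}_i$ is a closing on the lattice of subcomplexes of $\mathbb{C}$ (ordered by inclusion). Moreover, $\{\gamma^{\uparrow\downarrow}_i: i\in\mathbb{N}\}$ is a granulometry and $\{\phi^{\uparrow\downarrow}_i: i\in\mathbb{N}\}$ is an anti-granulometry.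
   Context: A simplex is a finite nonempty set; its dimension is its cardinality minus one. A simplicial complex is a set of simplices such that every nonempty subset of an element belongs to it; a subcomplex of $\mathbb{C}$ is a subset of $\mathbb{C}$ that is a simplicial complex. For $X\subseteq\mathbb{C}$, $X_i$ is the set of $i$-simplices of $X$ and $\mathbb{C}_i$ the set of $i$-simplices of $\mathbb{C}$. For $0\le a<b\le n$, $X\subseteq\mathbb{C}_a$, $Y\subseteq \mathbb{C}_b$: $\delta^+_{a,b}(X)=\{x\in\mathbb{C}_b:\exists y\in X,\ y\subseteq x\}$, $\varepsilon^+_{a,b}(X)=\{x\in\mathbb{C}_b:\forall y\in\mathbb{C}_a,\ y\subseteq x\Rightarrow y\in X\}$, $\delta^-_{b,a}(Y)=\{x\in\mathbb{C}_a:\exists y\in Y,\ x\subseteq y\}$, $\varepsilon^-_{b,a}(Y)=\{x\in\mathbb{C}_a:\forall y\in\mathbb{C}_b,\ x\subseteq y\Rightarrow y\in Y\}$. $Cl(X)=\bigcup_{x\in X}\{y: y\subseteq x,\ y\ne\emptyset\}$ for $X\subseteq\mathbb{C}$, and $Cl^\dagger(X)=\bigcup\{Y\subseteq\mathbb{C}: Cl(Y)\subseteq X\}$. For a subcomplex $X$ (composition by juxtaposition, powers denote iterated composition, power $0$ is the identity): $\delta^{\uparrow\downarrow}(X)=\bigcup_{i=0}^{n-1}\delta^-_{i+1,i}\delta^+_{i,i+1}(X_i)\ \cup\ \delta^+_{n-1,n}\delta^-_{n,n-1}(X_n)$, $\varepsilon^{\uparrow\downarrow}(X)=Cl^\dagger\Big(\bigcup_{i=0}^{n-1}\varepsilon^-_{i+1,i}\varepsilon^+_{i,i+1}(X_i)\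 \cup\ \varepsilon^+_{n-1,n}\varepsilon^-_{n,n-1}(X_n)\Big)$. An opening is an increasing, idempotent, anti-extensive operator; a closing is an increasing, idempotent, extensive operator. A family of openings $\{\psi_i\}_{i\in\mathbb{N}}$ is a granulometry if $i\ge j$ implies $\psi_i(X)\subseteq\psi_j(X)$ for all $X$; a family of closings $\{\zeta_i\}_{i\in\mathbb{N}}$ is an anti-granulometry if $i\le j$ implies $\zeta_i(X)\subseteq\zeta_j(X)$ for all $X$. -}

module Defs where

open import Level using (0ℓ)
open import Data.Bool using (Bool; true)
open import Data.Nat using (ℕ; zero; suc; _≤_; _<_; _∸_)
open import Data.Fin.Subset using (Subset; ∣_∣; Nonempty) renaming (_⊆_ to _⊆ˢ_)
open import Data.Product using (Σ; ∃; _×_; _,_)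
open import Data.Sum using (_⊎_)
open import Function using (id; _∘_)
open import Relation.Unary using (Pred; _∈_; _⊆_; _≐_)
open import Relation.Binary.PropositionalEquality using (_≡_)

-- Vertices are Fin m; a simplex is a subset of the vertex set
-- (only nonempty ones are ever members of a complex).
Simplex : ℕ → Set
Simplex m = Subset m

SSet : ℕ → Set₁
SSet m = Pred (Simplex m) 0ℓ

IsDim : ∀ {m} → ℕ → Simplex m → Set
IsDim i s = ∣ s ∣ ≡ suc i

SimplicialComplex : ∀ {m} → SSet m → Set
SimplicialComplex X =
  (∀ s → s ∈ X → Nonempty s) ×
  (∀ s t → s ∈ X → t ⊆ˢ s → Nonempty t → t ∈ X)

HasDim : ∀ {m} → SSet m → ℕ → Set
HasDim X n = (∃ λ s → s ∈ X × IsDim n s) × (∀ s → s ∈ X → ∣ s ∣ ≤ suc n)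

Subcomplex : ∀ {m} → SSet m → SSet m → Set
Subcomplex C X = X ⊆ C × SimplicialComplex X

layer : ∀ {m} → SSet m → ℕ → SSet m
layer X i s = s ∈ X × IsDim i s

module _ {m : ℕ} (C : SSet m) where

  δ⁺ : ℕ → ℕ → SSet m → SSet m
  δ⁺ a b X x = (x ∈ C × IsDim b x) × ∃ λ y → y ∈ X × y ⊆ˢ x

  ε⁺ : ℕ → ℕ → SSet m → SSet m
  ε⁺ a b X x = (x ∈ C × IsDim b x) ×
               (∀ y → y ∈ C → IsDim a y → y ⊆ˢ x → y ∈ X)

  δ⁻ : ℕ → ℕ → SSet m → SSet m
  δ⁻ b a Y x = (x ∈ C × IsDim a x) × ∃ λ y → y ∈ Y × x ⊆ˢ y

  ε⁻ : ℕ → ℕ → SSet m → SSet m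
  ε⁻ b a Y x = (x ∈ C × IsDim a x) ×
               (∀ y → y ∈ C → IsDim b y → x ⊆ˢ y → y ∈ Y)

  Cl : SSet m → SSet m
  Cl X x = Nonempty x × ∃ λ y → y ∈ X × x ⊆ˢ y

  -- Cl†(X) = ⋃ { Y ⊆ C : Cl(Y) ⊆ X }.  Subsets Y of the finite set of
  -- simplices are represented by their characteristic functions.
  Cl† : SSet m → SSet m
  Cl† X x = ∃ λ (Y : Simplex m → Bool) →
              (∀ y → Y y ≡ true → y ∈ C) ×
              (Cl (λ y → Y y ≡ true) ⊆ X) ×
              Y x ≡ true

  δ↑↓ : ℕ → SSet m → SSet m
  δ↑↓ n X x =
    (∃ λ i → i < n × δ⁻ (suc i) i (δ⁺ i (suc i) (layer X i)) x) ⊎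
    δ⁺ (n ∸ 1) n (δ⁻ n (n ∸ 1) (layer X n)) x

  ε↑↓ : ℕ → SSet m → SSet m
  ε↑↓ n X = Cl† (λ x →
    (∃ λ i → i < n × ε⁻ (suc i) i (ε⁺ i (suc i) (layer X i)) x) ⊎
    ε⁺ (n ∸ 1) n (ε⁻ n (n ∸ 1) (layer X n)) x)

_^[_] : ∀ {A : Set₁} → (A → A) → ℕ → A → A
f ^[ zero ] = id
f ^[ suc i ] = f ∘ (f ^[ i ])

γ↑↓ : ∀ {m} → SSet m → ℕ → ℕ → SSet m → SSet m
γ↑↓ C n i = (δ↑↓ C n ^[ i ]) ∘ (ε↑↓ C n ^[ i ])

φ↑↓ : ∀ {m} → SSet m → ℕ → ℕ → SSet m → SSet m
φ↑↓ C n i = (ε↑↓ C n ^[ i ]) ∘ (δ↑↓ C n ^[ i ])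

PreservesSubcomplexes : ∀ {m} → SSet m → (SSet m → SSet m) → Set₁
PreservesSubcomplexes C ψ = ∀ X → Subcomplex C X → Subcomplex C (ψ X)

Increasing : ∀ {m} → SSet m → (SSet m → SSet m) → Set₁
Increasing C ψ = ∀ X Y → Subcomplex C X → Subcomplex C Y → X ⊆ Y → ψ X ⊆ ψ Y

Idempotent : ∀ {m} → SSet m → (SSet m → SSet m) → Set₁
Idempotent C ψ = ∀ X → Subcomplex C X → ψ (ψ X) ≐ ψ X

AntiExtensive : ∀ {m} → SSet m → (SSet m → SSet m) → Set₁
AntiExtensive C ψ = ∀ X → Subcomplex C X → ψ X ⊆ X

Extensive : ∀ {m} → SSet m → (SSet m → SSet m) → Set₁
Extensive C ψ = ∀ X → Subcomplex C X → X ⊆ ψ X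

IsOpening : ∀ {m} → SSet m → (SSet m → SSet m) → Set₁
IsOpening C ψ = Increasing C ψ × Idempotent C ψ × AntiExtensive C ψ

IsClosing : ∀ {m} → SSet m → (SSet m → SSet m) → Set₁
IsClosing C ψ = Increasing C ψ × Idempotent C ψ × Extensive C ψ

IsGranulometry : ∀ {m} → SSet m → (ℕ → SSet m → SSet m) → Set₁
IsGranulometry C ψ =
  (∀ i → IsOpening C (ψ i)) ×
  (∀ i j → j ≤ i → ∀ X → Subcomplex C X → ψ i X ⊆ ψ j X)

IsAntiGranulometry : ∀ {m} → SSet m → (ℕ → SSet m → SSet m) → Set₁
IsAntiGranulometry C ζ =
  (∀ i → IsClosing C (ζ i)) ×
  (∀ i j → i ≤ j → ∀ X → Subcomplex C X → ζ i X ⊆ ζ j X)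

{-# OPTIONS --safe #-}
-- δ↑↓ and ε↑↓ form an adjunction on the subcomplexes of C: both are monotone,
-- both preserve subcomplexes, X ⊆ ε↑↓ (δ↑↓ X) and δ↑↓ (ε↑↓ Y) ⊆ Y. Powers of an
-- adjunction are adjunctions, and for every adjunction (δ, ε) the composite δε
-- is an opening and εδ a closing. The families are monotone in i because
-- δⁱ⁺¹εⁱ⁺¹ = δⁱ(δε)εⁱ ⊆ δⁱεⁱ by the counit, and dually for εⁱδⁱ.
-- The one combinatorial point is that δ↑↓ X is closed under faces: a face of a
-- simplex y ∈ C having a facet z ∈ X lies in a face of y one dimension higher
-- that meets z in a face of its own dimension, since z misses one vertex of y.
module Submission where

open import Defs
open import Data.Nat using (ℕ; _≤_)
open import Data.Product using (∃; _×_)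
open import Relation.Unary using (_∈_)

open import Data.Bool using (Bool; true) renaming (_≟_ to _≟ᴮ_)
open import Data.Empty using (⊥-elim)
open import Data.Fin using (zero; suc)
open import Data.Fin.Subset using (Subset; ∣_∣; Nonempty; inside; outside; _∩_; _∪_)
  renaming (_⊆_ to _⊆ˢ_)
open import Data.Fin.Subset.Properties
  using (drop-∷-⊆; out⊆; s⊆s; ⊆-trans; ⊆-refl; p⊆q⇒∣p∣≤∣q∣; p∩q⊆p; p∩q⊆q; ⊥⊆; x∈p∪q⁻)
open import Data.Nat using (zero; suc; _+_; _<_; _∸_; z≤n; s≤s; _≤′_; ≤′-refl; ≤′-step)
open import Data.Nat.Properties
  using (suc-injective; ≤-pred; n≤1+n; ≤-reflexive; ≤-trans; ≤-<-trans; <-irrefl; n≮n;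
         m≤n⇒m<n∨m≡n; m≤n+m∸n; +-suc; +-monoʳ-≤; +-cancelʳ-≤; ≤⇒≤′; module ≤-Reasoning)
open import Data.Product using (∃₂; _,_; proj₁; proj₂)
import Data.Product as Product
open import Data.Sum using (_⊎_; inj₁; inj₂; [_,_])
open import Data.Vec using (_∷_; []; here; there)
open import Data.Vec.Properties using (≡-dec)
open import Function using (_∘_; id)
open import Relation.Binary.PropositionalEquality using (_≡_; refl; sym; trans; cong; subst; subst₂)
open import Relation.Binary.Definitions using (DecidableEquality)
open import Relation.Nullary using (does; yes; no; contradiction)
open import Relation.Nullary.Decidable using (dec-true)
open import Relation.Unary using (_⊆_)

private
  variable
    m : ℕ
    p q r t w b : Subset m

nonempty⇒∣p∣≡suc : Nonempty p → ∃ λ k → ∣ p ∣ ≡ suc k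
nonempty⇒∣p∣≡suc {p = inside ∷ p} _ = ∣ p ∣ , refl
nonempty⇒∣p∣≡suc {p = outside ∷ p} (suc x , there x∈p) = nonempty⇒∣p∣≡suc (x , x∈p)

∣p∣≡suc⇒nonempty : ∀ {k} → ∣ p ∣ ≡ suc k → Nonempty p
∣p∣≡suc⇒nonempty {p = inside ∷ p} _ = zero , here
∣p∣≡suc⇒nonempty {p = outside ∷ p} ∣p∣≡1+k = Product.map suc there (∣p∣≡suc⇒nonempty ∣p∣≡1+k)

p⊆q∧∣q∣≤∣p∣⇒p≡q : p ⊆ˢ q → ∣ q ∣ ≤ ∣ p ∣ → p ≡ q
p⊆q∧∣q∣≤∣p∣⇒p≡q {p = []} {[]} _ _ = refl
p⊆q∧∣q∣≤∣p∣⇒p≡q {p = outside ∷ p} {outside ∷ q} p⊆q q≤p =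
  cong (outside ∷_) (p⊆q∧∣q∣≤∣p∣⇒p≡q (drop-∷-⊆ p⊆q) q≤p)
p⊆q∧∣q∣≤∣p∣⇒p≡q {p = inside ∷ p} {inside ∷ q} p⊆q (s≤s q≤p) =
  cong (inside ∷_) (p⊆q∧∣q∣≤∣p∣⇒p≡q (drop-∷-⊆ p⊆q) q≤p)
p⊆q∧∣q∣≤∣p∣⇒p≡q {p = inside ∷ p} {outside ∷ q} p⊆q _ = contradiction (p⊆q here) λ ()
p⊆q∧∣q∣≤∣p∣⇒p≡q {p = outside ∷ p} {inside ∷ q} p⊆q q<p =
  contradiction (≤-trans q<p (p⊆q⇒∣p∣≤∣q∣ (drop-∷-⊆ p⊆q))) (n≮n ∣ q ∣)

⊆-interpolate : p ⊆ˢ q → ∀ {k} → ∣ p ∣ ≤ k → k ≤ ∣ q ∣ →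
                ∃ λ r → p ⊆ˢ r × r ⊆ˢ q × ∣ r ∣ ≡ k
⊆-interpolate {p = []} {[]} _ z≤n z≤n = [] , ⊆-refl , ⊆-refl , refl
⊆-interpolate {p = outside ∷ p} {outside ∷ q} p⊆q p≤k k≤q =
  let r , p⊆r , r⊆q , ∣r∣≡k = ⊆-interpolate (drop-∷-⊆ p⊆q) p≤k k≤q
  in outside ∷ r , s⊆s p⊆r , s⊆s r⊆q , ∣r∣≡k
⊆-interpolate {p = inside ∷ p} {inside ∷ q} p⊆q (s≤s p≤k) (s≤s k≤q) =
  let r , p⊆r , r⊆q , ∣r∣≡k = ⊆-interpolate (drop-∷-⊆ p⊆q) p≤k k≤q
  in inside ∷ r , s⊆s p⊆r , s⊆s r⊆q , cong suc ∣r∣≡k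
⊆-interpolate {p = inside ∷ p} {outside ∷ q} p⊆q _ _ = contradiction (p⊆q here) λ ()
⊆-interpolate {p = outside ∷ p} {inside ∷ q} p⊆q p≤k k≤1+q with m≤n⇒m<n∨m≡n k≤1+q
... | inj₂ refl = inside ∷ q , p⊆q , ⊆-refl , refl
... | inj₁ k≤q =
  let r , p⊆r , r⊆q , ∣r∣≡k = ⊆-interpolate (drop-∷-⊆ p⊆q) p≤k (≤-pred k≤q)
  in outside ∷ r , s⊆s p⊆r , out⊆ r⊆q , ∣r∣≡k

∣p∩q∣+∣p∪q∣≡∣p∣+∣q∣ : ∀ (p q : Subset m) → ∣ p ∩ q ∣ + ∣ p ∪ q ∣ ≡ ∣ p ∣ + ∣ q ∣
∣p∩q∣+∣p∪q∣≡∣p∣+∣q∣ [] [] = refl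
∣p∩q∣+∣p∪q∣≡∣p∣+∣q∣ (outside ∷ p) (outside ∷ q) = ∣p∩q∣+∣p∪q∣≡∣p∣+∣q∣ p q
∣p∩q∣+∣p∪q∣≡∣p∣+∣q∣ (inside ∷ p) (outside ∷ q) =
  trans (+-suc ∣ p ∩ q ∣ ∣ p ∪ q ∣) (cong suc (∣p∩q∣+∣p∪q∣≡∣p∣+∣q∣ p q))
∣p∩q∣+∣p∪q∣≡∣p∣+∣q∣ (outside ∷ p) (inside ∷ q) =
  trans (+-suc ∣ p ∩ q ∣ ∣ p ∪ q ∣)
        (trans (cong suc (∣p∩q∣+∣p∪q∣≡∣p∣+∣q∣ p q)) (sym (+-suc ∣ p ∣ ∣ q ∣)))
∣p∩q∣+∣p∪q∣≡∣p∣+∣q∣ (inside ∷ p) (inside ∷ q) =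
  cong suc (trans (+-suc ∣ p ∩ q ∣ ∣ p ∪ q ∣)
                  (trans (cong suc (∣p∩q∣+∣p∪q∣≡∣p∣+∣q∣ p q)) (sym (+-suc ∣ p ∣ ∣ q ∣))))

p⊆r∧q⊆r⇒p∪q⊆r : p ⊆ˢ r → q ⊆ˢ r → p ∪ q ⊆ˢ r
p⊆r∧q⊆r⇒p∪q⊆r {p = p} {q = q} p⊆r q⊆r x∈p∪q = [ p⊆r , q⊆r ] (x∈p∪q⁻ p q x∈p∪q)

∣p∣≤1+∣p∩q∣ : p ⊆ˢ r → q ⊆ˢ r → ∣ r ∣ ≤ suc ∣ q ∣ → ∣ p ∣ ≤ suc ∣ p ∩ q ∣
∣p∣≤1+∣p∩q∣ {p = p} {q = q} p⊆r q⊆r r≤1+q = +-cancelʳ-≤ ∣ q ∣ ∣ p ∣ (suc ∣ p ∩ q ∣) (begin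
  ∣ p ∣ + ∣ q ∣          ≡⟨ sym (∣p∩q∣+∣p∪q∣≡∣p∣+∣q∣ p q) ⟩
  ∣ p ∩ q ∣ + ∣ p ∪ q ∣  ≤⟨ +-monoʳ-≤ ∣ p ∩ q ∣ (≤-trans (p⊆q⇒∣p∣≤∣q∣ (p⊆r∧q⊆r⇒p∪q⊆r p⊆r q⊆r)) r≤1+q) ⟩
  ∣ p ∩ q ∣ + suc ∣ q ∣  ≡⟨ +-suc ∣ p ∩ q ∣ ∣ q ∣ ⟩
  suc ∣ p ∩ q ∣ + ∣ q ∣  ∎)
  where open ≤-Reasoning

-- Since w misses at most one vertex of b, y ∩ w has at least ∣ y ∣ − 1 = ∣ t ∣ elements.
face-extension : w ⊆ˢ b → ∣ b ∣ ≤ suc ∣ w ∣ → t ⊆ˢ b → suc ∣ t ∣ ≤ ∣ b ∣ →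
                 ∃₂ λ y v → t ⊆ˢ y × y ⊆ˢ b × ∣ y ∣ ≡ suc ∣ t ∣ × v ⊆ˢ y × v ⊆ˢ w × ∣ v ∣ ≡ ∣ t ∣
face-extension {w = w} {t = t} w⊆b b≤1+w t⊆b t<b =
  let y , t⊆y , y⊆b , ∣y∣≡1+∣t∣ = ⊆-interpolate t⊆b (n≤1+n ∣ t ∣) t<b
      t≤y∩w = ≤-pred (subst (_≤ suc ∣ y ∩ w ∣) ∣y∣≡1+∣t∣ (∣p∣≤1+∣p∩q∣ y⊆b w⊆b b≤1+w))
      v , _ , v⊆y∩w , ∣v∣≡∣t∣ = ⊆-interpolate ⊥⊆ (p⊆q⇒∣p∣≤∣q∣ (⊥⊆ {p = t})) t≤y∩w
  in y , v , t⊆y , y⊆b , ∣y∣≡1+∣t∣ ,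
     ⊆-trans v⊆y∩w (p∩q⊆p y w) , ⊆-trans v⊆y∩w (p∩q⊆q y w) , ∣v∣≡∣t∣

^[]-mono : ∀ {f : SSet m → SSet m} → (∀ {X Y} → X ⊆ Y → f X ⊆ f Y) →
           ∀ i {X Y} → X ⊆ Y → (f ^[ i ]) X ⊆ (f ^[ i ]) Y
^[]-mono f-mono zero    = id
^[]-mono f-mono (suc i) = f-mono ∘ ^[]-mono f-mono i

^[]-preserves : ∀ {C} {f : SSet m → SSet m} → PreservesSubcomplexes C f →
                ∀ i → PreservesSubcomplexes C (f ^[ i ])
^[]-preserves f-pres zero    X X-sub = X-sub
^[]-preserves f-pres (suc i) X X-sub = f-pres _ (^[]-preserves f-pres i X X-sub)

^[]-sucʳ : ∀ {A : Set₁} (f : A → A) i x → (f ^[ suc i ]) x ≡ (f ^[ i ]) (f x)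
^[]-sucʳ f zero    x = refl
^[]-sucʳ f (suc i) x = cong f (^[]-sucʳ f i x)

record IsAdjunction (C : SSet m) (δ ε : SSet m → SSet m) : Set₁ where
  field
    δ-mono      : ∀ {X Y} → X ⊆ Y → δ X ⊆ δ Y
    ε-mono      : ∀ {X Y} → X ⊆ Y → ε X ⊆ ε Y
    δ-preserves : PreservesSubcomplexes C δ
    ε-preserves : PreservesSubcomplexes C ε
    unit        : ∀ X → Subcomplex C X → X ⊆ ε (δ X)
    counit      : ∀ Y → Subcomplex C Y → δ (ε Y) ⊆ Y

module _ {C : SSet m} {δ ε : SSet m → SSet m} (adj : IsAdjunction C δ ε) where
  open IsAdjunction adj

  δε-preserves : PreservesSubcomplexes C (δ ∘ ε)
  δε-preserves X X-sub = δ-preserves _ (ε-preserves X X-sub)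

  εδ-preserves : PreservesSubcomplexes C (ε ∘ δ)
  εδ-preserves X X-sub = ε-preserves _ (δ-preserves X X-sub)

  δε-isOpening : IsOpening C (δ ∘ ε)
  δε-isOpening =
    (λ _ _ _ _ → δ-mono ∘ ε-mono) ,
    (λ X X-sub → counit _ (δε-preserves X X-sub) , δ-mono (unit _ (ε-preserves X X-sub))) ,
    counit

  εδ-isClosing : IsClosing C (ε ∘ δ)
  εδ-isClosing =
    (λ _ _ _ _ → ε-mono ∘ δ-mono) ,
    (λ X X-sub → ε-mono (counit _ (δ-preserves X X-sub)) , unit _ (εδ-preserves X X-sub)) ,
    unit

  δ^[]ε^[]-shrinks : ∀ i X → Subcomplex C X →
                     (δ ^[ suc i ]) ((ε ^[ suc i ]) X) ⊆ (δ ^[ i ]) ((ε ^[ i ]) X)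
  δ^[]ε^[]-shrinks i X X-sub {x} =
    ^[]-mono δ-mono i (counit _ (^[]-preserves ε-preserves i X X-sub))
    ∘ subst (x ∈_) (^[]-sucʳ δ i _)

  ε^[]δ^[]-grows : ∀ i X → Subcomplex C X →
                   (ε ^[ i ]) ((δ ^[ i ]) X) ⊆ (ε ^[ suc i ]) ((δ ^[ suc i ]) X)
  ε^[]δ^[]-grows i X X-sub {x} =
    subst (x ∈_) (sym (^[]-sucʳ ε i _))
    ∘ ^[]-mono ε-mono i (unit _ (^[]-preserves δ-preserves i X X-sub))

  ^[]-isAdjunction : ∀ i → IsAdjunction C (δ ^[ i ]) (ε ^[ i ])
  ^[]-isAdjunction i = record
    { δ-mono      = ^[]-mono δ-mono i
    ; ε-mono      = ^[]-mono ε-mono i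
    ; δ-preserves = ^[]-preserves δ-preserves i
    ; ε-preserves = ^[]-preserves ε-preserves i
    ; unit        = ^[]-unit i
    ; counit      = ^[]-counit i
    }
    where
    ^[]-unit : ∀ i X → Subcomplex C X → X ⊆ (ε ^[ i ]) ((δ ^[ i ]) X)
    ^[]-unit zero    X X-sub = id
    ^[]-unit (suc i) X X-sub = ε^[]δ^[]-grows i X X-sub ∘ ^[]-unit i X X-sub

    ^[]-counit : ∀ i Y → Subcomplex C Y → (δ ^[ i ]) ((ε ^[ i ]) Y) ⊆ Y
    ^[]-counit zero    Y Y-sub = id
    ^[]-counit (suc i) Y Y-sub = ^[]-counit i Y Y-sub ∘ δ^[]ε^[]-shrinks i Y Y-sub

module _ {C : SSet m} (ψ : ℕ → SSet m → SSet m) where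

  antitone-by-step : (∀ i X → Subcomplex C X → ψ (suc i) X ⊆ ψ i X) →
                     ∀ i j → j ≤ i → ∀ X → Subcomplex C X → ψ i X ⊆ ψ j X
  antitone-by-step step i j j≤i X X-sub = go (≤⇒≤′ j≤i)
    where
    go : ∀ {i} → j ≤′ i → ψ i X ⊆ ψ j X
    go ≤′-refl         = id
    go (≤′-step j≤′i) = go j≤′i ∘ step _ X X-sub

  monotone-by-step : (∀ i X → Subcomplex C X → ψ i X ⊆ ψ (suc i) X) →
                     ∀ i j → i ≤ j → ∀ X → Subcomplex C X → ψ i X ⊆ ψ j X
  monotone-by-step step i j i≤j X X-sub = go (≤⇒≤′ i≤j)
    where
    go : ∀ {j} → i ≤′ j → ψ i X ⊆ ψ j X
    go ≤′-refl         = id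
    go (≤′-step i≤′j) = step _ X X-sub ∘ go i≤′j

IsDim-injective : ∀ {i j} (s : Simplex m) → IsDim i s → IsDim j s → i ≡ j
IsDim-injective _ ∣s∣≡1+i ∣s∣≡1+j = suc-injective (trans (sym ∣s∣≡1+i) ∣s∣≡1+j)

face∈complex : ∀ {K : SSet m} {s t k} → SimplicialComplex K → s ∈ K → t ⊆ˢ s → ∣ t ∣ ≡ suc k → t ∈ K
face∈complex K-complex s∈K t⊆s ∣t∣≡1+k = proj₂ K-complex _ _ s∈K t⊆s (∣p∣≡suc⇒nonempty ∣t∣≡1+k)

module _ (C : SSet m) where

  Cl†-mono : ∀ {S S′ : SSet m} → S ⊆ S′ → Cl† C S ⊆ Cl† C S′
  Cl†-mono S⊆S′ (Y , Y⊆C , ClY⊆S , x∈Y) = Y , Y⊆C , S⊆S′ ∘ ClY⊆S , x∈Y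

  Cl†⁺ : ∀ {S : SSet m} {x} → x ∈ C → (∀ u → Nonempty u → u ⊆ˢ x → u ∈ S) → x ∈ Cl† C S
  Cl†⁺ {S} {x} x∈C faces∈S = is-x , only-x∈C , Cl-x⊆S , dec-true (x ≟ x) refl
    where
    _≟_ : DecidableEquality (Simplex m)
    _≟_ = ≡-dec _≟ᴮ_

    is-x : Simplex m → Bool
    is-x y = does (y ≟ x)

    is-x-sound : ∀ {y} → is-x y ≡ true → y ≡ x
    is-x-sound {y} with y ≟ x
    ... | yes y≡x = λ _ → y≡x
    ... | no _    = λ ()

    only-x∈C : ∀ y → is-x y ≡ true → y ∈ C
    only-x∈C y y-is-x = subst (_∈ C) (sym (is-x-sound y-is-x)) x∈C

    Cl-x⊆S : Cl C (λ y → is-x y ≡ true) ⊆ S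
    Cl-x⊆S {u} (u-ne , y , y-is-x , u⊆y) = faces∈S u u-ne (subst (u ⊆ˢ_) (is-x-sound y-is-x) u⊆y)

  Cl†⁻ : ∀ {S : SSet m} {x} → x ∈ Cl† C S → x ∈ C × (∀ u → Nonempty u → u ⊆ˢ x → u ∈ S)
  Cl†⁻ {x = x} (Y , Y⊆C , ClY⊆S , x∈Y) = Y⊆C x x∈Y , λ u u-ne u⊆x → ClY⊆S (u-ne , x , x∈Y , u⊆x)

  ∈Cl†⇒∈ : ∀ {S : SSet m} {x} → x ∈ Cl† C S → Nonempty x → x ∈ S
  ∈Cl†⇒∈ x∈Cl†S x-ne = proj₂ (Cl†⁻ x∈Cl†S) _ x-ne ⊆-refl

  Cl†-subcomplex : SimplicialComplex C → ∀ S → Subcomplex C (Cl† C S)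
  Cl†-subcomplex C-complex S =
    proj₁ ∘ Cl†⁻ ,
    (λ x x∈Cl†S → proj₁ C-complex x (proj₁ (Cl†⁻ x∈Cl†S))) ,
    λ x t x∈Cl†S t⊆x t-ne →
      let x∈C , faces∈S = Cl†⁻ x∈Cl†S
      in Cl†⁺ (proj₂ C-complex x t x∈C t⊆x t-ne) λ u u-ne u⊆t → faces∈S u u-ne (⊆-trans u⊆t t⊆x)

  module _ (n : ℕ) where

    -- The argument of Cl† in ε↑↓, so that ε↑↓ C n X = Cl† C (ε↑↓-core X).
    ε↑↓-core : SSet m → SSet m
    ε↑↓-core X x =
      (∃ λ i → i < n × ε⁻ C (suc i) i (ε⁺ C i (suc i) (layer X i)) x) ⊎
      ε⁺ C (n ∸ 1) n (ε⁻ C n (n ∸ 1) (layer X n)) x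

    δ↑↓-mono : ∀ {X Y : SSet m} → X ⊆ Y → δ↑↓ C n X ⊆ δ↑↓ C n Y
    δ↑↓-mono X⊆Y (inj₁ (i , i<n , x-dim , y , (y-dim , z , (z∈X , z-dim) , z⊆y) , x⊆y)) =
      inj₁ (i , i<n , x-dim , y , (y-dim , z , (X⊆Y z∈X , z-dim) , z⊆y) , x⊆y)
    δ↑↓-mono X⊆Y (inj₂ (x-dim , w , (w-dim , z , (z∈X , z-dim) , w⊆z) , w⊆x)) =
      inj₂ (x-dim , w , (w-dim , z , (X⊆Y z∈X , z-dim) , w⊆z) , w⊆x)

    ε↑↓-core-mono : ∀ {X Y : SSet m} → X ⊆ Y → ε↑↓-core X ⊆ ε↑↓-core Y
    ε↑↓-core-mono X⊆Y (inj₁ (i , i<n , x-dim , up)) =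
      inj₁ (i , i<n , x-dim , λ y y∈C y-dim x⊆y →
        Product.map₂ (λ down z z∈C z-dim z⊆y → Product.map₁ X⊆Y (down z z∈C z-dim z⊆y))
                     (up y y∈C y-dim x⊆y))
    ε↑↓-core-mono X⊆Y (inj₂ (x-dim , down)) =
      inj₂ (x-dim , λ w w∈C w-dim w⊆x →
        Product.map₂ (λ up y y∈C y-dim w⊆y → Product.map₁ X⊆Y (up y y∈C y-dim w⊆y))
                     (down w w∈C w-dim w⊆x))

    ε↑↓-mono : ∀ {X Y : SSet m} → X ⊆ Y → ε↑↓ C n X ⊆ ε↑↓ C n Y
    ε↑↓-mono = Cl†-mono ∘ ε↑↓-core-mono

    δ↑↓ε↑↓-counit : ∀ Y → δ↑↓ C n (ε↑↓ C n Y) ⊆ Y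
    δ↑↓ε↑↓-counit Y {x}
      (inj₁ (i , i<n , (x∈C , x-dim) , y , ((y∈C , y-dim) , z , (z∈εY , z-dim) , z⊆y) , x⊆y))
      with ∈Cl†⇒∈ z∈εY (∣p∣≡suc⇒nonempty z-dim)
    ... | inj₁ (_ , _ , (_ , z-dim′) , up) with refl ← IsDim-injective z z-dim z-dim′ =
      proj₁ (proj₂ (up y y∈C y-dim z⊆y) x x∈C x-dim x⊆y)
    ... | inj₂ ((_ , z-dimₙ) , _) = ⊥-elim (<-irrefl (IsDim-injective z z-dim z-dimₙ) i<n)
    δ↑↓ε↑↓-counit Y {x}
      (inj₂ ((x∈C , x-dim) , w , ((w∈C , w-dim) , z , (z∈εY , z-dim) , w⊆z) , w⊆x))
      with ∈Cl†⇒∈ z∈εY (∣p∣≡suc⇒nonempty z-dim)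
    ... | inj₁ (_ , i<n , (_ , z-dimᵢ) , _) = ⊥-elim (<-irrefl (IsDim-injective z z-dimᵢ z-dim) i<n)
    ... | inj₂ (_ , down) = proj₁ (proj₂ (down w w∈C w-dim w⊆z) x x∈C x-dim w⊆x)

    δ↑↓⊆C : ∀ {X} → δ↑↓ C n X ⊆ C
    δ↑↓⊆C (inj₁ (_ , _ , (x∈C , _) , _)) = x∈C
    δ↑↓⊆C (inj₂ ((x∈C , _) , _))         = x∈C

    δ↑↓-nonempty : ∀ {X} x → x ∈ δ↑↓ C n X → Nonempty x
    δ↑↓-nonempty _ (inj₁ (_ , _ , (_ , x-dim) , _)) = ∣p∣≡suc⇒nonempty x-dim
    δ↑↓-nonempty _ (inj₂ ((_ , x-dim) , _))         = ∣p∣≡suc⇒nonempty x-dim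

    module _ (C-complex : SimplicialComplex C) {X : SSet m} (X-sub : Subcomplex C X) where

      proper-face∈δ↑↓ : ∀ {b w t j} → b ∈ C → w ∈ X → w ⊆ˢ b → ∣ b ∣ ≤ suc ∣ w ∣ →
                        t ⊆ˢ b → suc ∣ t ∣ ≤ ∣ b ∣ → IsDim j t → j < n → t ∈ δ↑↓ C n X
      proper-face∈δ↑↓ b∈C w∈X w⊆b b≤1+w t⊆b t<b t-dim j<n =
        let y , v , t⊆y , y⊆b , ∣y∣≡1+∣t∣ , v⊆y , v⊆w , ∣v∣≡∣t∣ = face-extension w⊆b b≤1+w t⊆b t<b
            y-dim = trans ∣y∣≡1+∣t∣ (cong suc t-dim)
            v-dim = trans ∣v∣≡∣t∣ t-dim
        in inj₁ (_ , j<n , (face∈complex C-complex b∈C t⊆b t-dim , t-dim) , y ,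
                 ((face∈complex C-complex b∈C y⊆b y-dim , y-dim) , v ,
                  (face∈complex (proj₂ X-sub) w∈X v⊆w v-dim , v-dim) , v⊆y) ,
                 t⊆y)

      face∈δ↑↓ : ∀ {x t j} → x ∈ δ↑↓ C n X → t ⊆ˢ x → IsDim j t → t ∈ δ↑↓ C n X
      face∈δ↑↓ {x} {t}
        (inj₁ (i , i<n , (_ , x-dim) , y , ((y∈C , y-dim) , z , (z∈X , z-dim) , z⊆y) , x⊆y)) t⊆x t-dim =
        proper-face∈δ↑↓ y∈C z∈X z⊆y (≤-reflexive (trans y-dim (cong suc (sym z-dim))))
          (⊆-trans t⊆x x⊆y) (subst (suc ∣ t ∣ ≤_) (trans (cong suc x-dim) (sym y-dim)) (s≤s t≤x))
          t-dim (≤-<-trans (≤-pred (subst₂ _≤_ t-dim x-dim t≤x)) i<n)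
        where
        t≤x : ∣ t ∣ ≤ ∣ x ∣
        t≤x = p⊆q⇒∣p∣≤∣q∣ t⊆x
      face∈δ↑↓ x∈δ↑↓X@(inj₂ ((x∈C , x-dim) , w , ((_ , w-dim) , z , (z∈X , _) , w⊆z) , w⊆x))
               t⊆x t-dim with m≤n⇒m<n∨m≡n (≤-pred (subst₂ _≤_ t-dim x-dim (p⊆q⇒∣p∣≤∣q∣ t⊆x)))
      ... | inj₁ j<n =
        proper-face∈δ↑↓ x∈C (face∈complex (proj₂ X-sub) z∈X w⊆z w-dim) w⊆x
          (subst₂ _≤_ (sym x-dim) (cong suc (sym w-dim)) (s≤s (m≤n+m∸n n 1))) t⊆x
          (subst₂ _≤_ (cong suc (sym t-dim)) (sym x-dim) (s≤s j<n)) t-dim j<n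
      ... | inj₂ refl =
        subst (_∈ δ↑↓ C n X) (sym (p⊆q∧∣q∣≤∣p∣⇒p≡q t⊆x (≤-reflexive (trans x-dim (sym t-dim))))) x∈δ↑↓X

    δ↑↓-preserves : SimplicialComplex C → PreservesSubcomplexes C (δ↑↓ C n)
    δ↑↓-preserves C-complex X X-sub =
      δ↑↓⊆C , δ↑↓-nonempty , λ x t x∈δ↑↓X t⊆x t-ne →
        face∈δ↑↓ C-complex X-sub x∈δ↑↓X t⊆x (proj₂ (nonempty⇒∣p∣≡suc t-ne))

    module _ (dim≤n : ∀ s → s ∈ C → ∣ s ∣ ≤ suc n) {X : SSet m} (X-sub : Subcomplex C X) where

      ∈ε↑↓-core-δ↑↓ : ∀ {x i} → x ∈ X → IsDim i x → i ≤ n → x ∈ ε↑↓-core (δ↑↓ C n X)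
      ∈ε↑↓-core-δ↑↓ {x} {i} x∈X x-dim i≤n with m≤n⇒m<n∨m≡n i≤n
      ... | inj₁ i<n =
        inj₁ (i , i<n , (proj₁ X-sub x∈X , x-dim) , λ y y∈C y-dim x⊆y → (y∈C , y-dim) ,
          λ z z∈C z-dim z⊆y →
            inj₁ (i , i<n , (z∈C , z-dim) , y , ((y∈C , y-dim) , x , (x∈X , x-dim) , x⊆y) , z⊆y) , z-dim)
      ... | inj₂ refl =
        inj₂ ((proj₁ X-sub x∈X , x-dim) , λ w w∈C w-dim w⊆x → (w∈C , w-dim) ,
          λ y y∈C y-dim w⊆y →
            inj₂ ((y∈C , y-dim) , w , ((w∈C , w-dim) , x , (x∈X , x-dim) , w⊆x) , w⊆y) , y-dim)

      X⊆ε↑↓δ↑↓ : X ⊆ ε↑↓ C n (δ↑↓ C n X)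
      X⊆ε↑↓δ↑↓ {x} x∈X = Cl†⁺ (proj₁ X-sub x∈X) λ u u-ne u⊆x →
        let u∈X = proj₂ (proj₂ X-sub) x u x∈X u⊆x u-ne
            _ , u-dim = nonempty⇒∣p∣≡suc u-ne
        in ∈ε↑↓-core-δ↑↓ u∈X u-dim (≤-pred (subst (_≤ suc n) u-dim (dim≤n u (proj₁ X-sub u∈X))))

↑↓-isAdjunction : ∀ {C : SSet m} n → SimplicialComplex C → (∀ s → s ∈ C → ∣ s ∣ ≤ suc n) →
                  IsAdjunction C (δ↑↓ C n) (ε↑↓ C n)
↑↓-isAdjunction {C = C} n C-complex dim≤n = record
  { δ-mono      = δ↑↓-mono C n
  ; ε-mono      = ε↑↓-mono C n
  ; δ-preserves = δ↑↓-preserves C n C-complex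
  ; ε-preserves = λ X _ → Cl†-subcomplex C C-complex _
  ; unit        = λ X X-sub → X⊆ε↑↓δ↑↓ C n dim≤n X-sub
  ; counit      = λ Y _ → δ↑↓ε↑↓-counit C n Y
  }

mainTheorem9 : ∀ {m : ℕ} (C : SSet m) (n : ℕ) →
    SimplicialComplex C → (∃ λ s → s ∈ C) → HasDim C n → 1 ≤ n →
    (∀ i → PreservesSubcomplexes C (γ↑↓ C n i)) ×
    (∀ i → PreservesSubcomplexes C (φ↑↓ C n i)) ×
    (∀ i → IsOpening C (γ↑↓ C n i)) ×
    (∀ i → IsClosing C (φ↑↓ C n i)) ×
    IsGranulometry C (γ↑↓ C n) ×
    IsAntiGranulometry C (φ↑↓ C n)
mainTheorem9 C n C-complex _ (_ , dim≤n) _ =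
  (λ i → δε-preserves (adj i)) ,
  (λ i → εδ-preserves (adj i)) ,
  (λ i → δε-isOpening (adj i)) ,
  (λ i → εδ-isClosing (adj i)) ,
  ((λ i → δε-isOpening (adj i)) , antitone-by-step (γ↑↓ C n) (δ^[]ε^[]-shrinks adj₁)) ,
  ((λ i → εδ-isClosing (adj i)) , monotone-by-step (φ↑↓ C n) (ε^[]δ^[]-grows adj₁))
  where
  adj₁ : IsAdjunction C (δ↑↓ C n) (ε↑↓ C n)
  adj₁ = ↑↓-isAdjunction n C-complex dim≤n

  adj : ∀ i → IsAdjunction C (δ↑↓ C n ^[ i ]) (ε↑↓ C n ^[ i ])
  adj = ^[]-isAdjunction adj₁
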